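{- Let $n$ be a natural number. If $\mathcal{M}\vDash\mathsf{DB}_0+\mathsf{Coll}(\Sigma_1)$ has an end extension $\mathcal{N}$ which is taller than $\mathcal{M}$ and satisfies $\mathcal{M}\prec_{\Sigma_{n+2}}\mathcal{N}$, then $\mathcal{M}\vDash\mathsf{Coll}(\Sigma_{n+2})$.
   Context: Language $\mathcal{L}_\in=\{\in,=\}$, Lévy hierarchy. $\mathsf{DB}_0$ consists of extensionality, nullset, pairing, union, cartesian product and $\Delta_0$-separation. $\mathsf{Coll}(\Sigma_k)$ is the schema of $\forall v\forall p(\forall x\in p\exists y\,\varphi(x,y,v)\to\exists q\forall x\in p\exists y\in q\,\varphi(x,y,v))$ for $\Sigma_k$ formulas $\varphi$. $\mathcal{N}$ is an end extension of $\mathcal{M}$ if $M\subseteq N$ and $\mathcal{N}\vDash x\in m$ with $m\in M$ implies $x\in M$. $\mathcal{N}$ is taller than $\mathcal{M}$ if some $c\in N$ satisfies $\mathcal{N}\vDash m\in c$ for all $m\in M$. $\prec_{\Sigma_k}$ denotes $\Sigma_k$-elementary substructure. -}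

module Defs where

open import Data.Nat using (ℕ; zero; suc)
open import Data.Product using (Σ; _×_; _,_; ∃)
open import Data.Sum using (_⊎_)
open import Data.Empty using (⊥)
open import Relation.Nullary using (¬_)
open import Relation.Binary.PropositionalEquality using (_≡_)
open import Function using (_∘_)

_⇔_ : Set → Set → Set
A ⇔ B = (A → B) × (B → A)

-- Formulas of L_∈ = {∈, =}, de Bruijn variables (ℕ).
-- Quantifiers bind variable 0; bounded quantifiers ∀x∈v_i / ∃x∈v_i, where
-- the index i refers to the context OUTSIDE the quantifier.
data Formula : Set where
  _∈̇_ : ℕ → ℕ → Formula
  _≐_ : ℕ → ℕ → Formula
  ¬̇_  : Formula → Formula
  _∧̇_ : Formula → Formula → Formula
  _∨̇_ : Formula → Formula → Formula
  _⇒̇_ : Formula → Formula → Formula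
  ∀̇_  : Formula → Formula
  ∃̇_  : Formula → Formula
  ∀∈̇  : ℕ → Formula → Formula
  ∃∈̇  : ℕ → Formula → Formula

data Δ₀ : Formula → Set where
  mem  : ∀ i j → Δ₀ (i ∈̇ j)
  eq   : ∀ i j → Δ₀ (i ≐ j)
  neg  : ∀ {φ} → Δ₀ φ → Δ₀ (¬̇ φ)
  and  : ∀ {φ ψ} → Δ₀ φ → Δ₀ ψ → Δ₀ (φ ∧̇ ψ)
  or   : ∀ {φ ψ} → Δ₀ φ → Δ₀ ψ → Δ₀ (φ ∨̇ ψ)
  imp  : ∀ {φ ψ} → Δ₀ φ → Δ₀ ψ → Δ₀ (φ ⇒̇ ψ)
  ball : ∀ i {φ} → Δ₀ φ → Δ₀ (∀∈̇ i φ)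
  bex  : ∀ i {φ} → Δ₀ φ → Δ₀ (∃∈̇ i φ)

mutual
  data IsΣ : ℕ → Formula → Set where
    Σ-Δ₀ : ∀ {k φ} → Δ₀ φ → IsΣ k φ
    Σ-∃  : ∀ {k φ} → IsΣ (suc k) φ → IsΣ (suc k) (∃̇ φ)
    Σ-Π  : ∀ {k φ} → IsΠ k φ → IsΣ (suc k) φ

  data IsΠ : ℕ → Formula → Set where
    Π-Δ₀ : ∀ {k φ} → Δ₀ φ → IsΠ k φ
    Π-∀  : ∀ {k φ} → IsΠ (suc k) φ → IsΠ (suc k) (∀̇ φ)
    Π-Σ  : ∀ {k φ} → IsΣ k φ → IsΠ (suc k) φ

-- L_∈-structures; '=' is interpreted as actual equality of the carrier.
record Structure : Set₁ where
  field
    Carrier : Set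
    _∈_     : Carrier → Carrier → Set

Env : Set → Set
Env A = ℕ → A

_∷ₑ_ : {A : Set} → A → Env A → Env A
(a ∷ₑ ρ) zero    = a
(a ∷ₑ ρ) (suc i) = ρ i

Sat : (S : Structure) → Formula → Env (Structure.Carrier S) → Set
Sat S (i ∈̇ j) ρ = Structure._∈_ S (ρ i) (ρ j)
Sat S (i ≐ j) ρ = ρ i ≡ ρ j
Sat S (¬̇ φ) ρ = ¬ Sat S φ ρ
Sat S (φ ∧̇ ψ) ρ = Sat S φ ρ × Sat S ψ ρ
Sat S (φ ∨̇ ψ) ρ = Sat S φ ρ ⊎ Sat S ψ ρ
Sat S (φ ⇒̇ ψ) ρ = Sat S φ ρ → Sat S ψ ρ
Sat S (∀̇ φ) ρ = ∀ x → Sat S φ (x ∷ₑ ρ)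
Sat S (∃̇ φ) ρ = Σ (Structure.Carrier S) λ x → Sat S φ (x ∷ₑ ρ)
Sat S (∀∈̇ i φ) ρ = ∀ x → Structure._∈_ S x (ρ i) → Sat S φ (x ∷ₑ ρ)
Sat S (∃∈̇ i φ) ρ = Σ (Structure.Carrier S) λ x → Structure._∈_ S x (ρ i) × Sat S φ (x ∷ₑ ρ)

module _ (S : Structure) where
  open Structure S renaming (Carrier to M)

  IsSingleton : M → M → Set
  IsSingleton s u = ∀ w → (w ∈ s) ⇔ (w ≡ u)

  IsDoubleton : M → M → M → Set
  IsDoubleton d u v = ∀ w → (w ∈ d) ⇔ ((w ≡ u) ⊎ (w ≡ v))

  IsPair : M → M → M → Set
  IsPair p u v = ∀ w → (w ∈ p) ⇔ (IsSingleton w u ⊎ IsDoubleton w u v)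

  Extensionality : Set
  Extensionality = ∀ a b → (∀ x → (x ∈ a) ⇔ (x ∈ b)) → a ≡ b

  Nullset : Set
  Nullset = Σ M λ e → ∀ x → ¬ (x ∈ e)

  Pairing : Set
  Pairing = ∀ a b → Σ M λ c → IsDoubleton c a b

  Union : Set
  Union = ∀ a → Σ M λ c → ∀ x → (x ∈ c) ⇔ (Σ M λ y → (y ∈ a) × (x ∈ y))

  CartesianProduct : Set
  CartesianProduct = ∀ a b → Σ M λ c → ∀ w →
    (w ∈ c) ⇔ (Σ M λ u → Σ M λ v → (u ∈ a) × (v ∈ b) × IsPair w u v)

  Δ₀-Separation : Set
  Δ₀-Separation = ∀ φ → Δ₀ φ → ∀ (ρ : Env M) a → Σ M λ b → ∀ x →
    (x ∈ b) ⇔ ((x ∈ a) × Sat S φ (x ∷ₑ ρ))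

  DB₀ : Set
  DB₀ = Extensionality × Nullset × Pairing × Union × CartesianProduct × Δ₀-Separation

  Coll : ℕ → Set
  Coll k = ∀ φ → IsΣ k φ → ∀ (ρ : Env M) (p : M) →
    (∀ x → x ∈ p → Σ M λ y → Sat S φ (y ∷ₑ (x ∷ₑ ρ))) →
    Σ M λ q → ∀ x → x ∈ p → Σ M λ y → (y ∈ q) × Sat S φ (y ∷ₑ (x ∷ₑ ρ))

-- N extends M via the identification f : M → N (M ⊆ N as a substructure:
-- f injective and ∈ preserved and reflected).
module _ (M N : Structure) where
  open Structure M renaming (Carrier to |M|; _∈_ to _∈M_)
  open Structure N renaming (Carrier to |N|; _∈_ to _∈N_)

  IsSubstructure : (|M| → |N|) → Set
  IsSubstructure f = (∀ a b → f a ≡ f b → a ≡ b) × (∀ a b → (a ∈M b) ⇔ (f a ∈N f b))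

  IsEndExtension : (|M| → |N|) → Set
  IsEndExtension f = IsSubstructure f × (∀ x m → x ∈N f m → Σ |M| λ a → f a ≡ x)

  IsTaller : (|M| → |N|) → Set
  IsTaller f = Σ |N| λ c → ∀ m → f m ∈N c

  ΣElementary : ℕ → (|M| → |N|) → Set
  ΣElementary k f = IsSubstructure f ×
    (∀ φ → IsΣ k φ → ∀ (ρ : Env |M|) → Sat M φ ρ ⇔ Sat N φ (f ∘ ρ))

-- Classical logic (the ambient metatheory of the paper).
LEM : Set₁
LEM = (P : Set) → P ⊎ ¬ P

module Submission where

-- Let φ(x, y) = ∃w̄ π with π ∈ Π_k and M ⊨ ∀x∈p ∃y φ. Witnesses y, w̄ chosen in M still satisfy π
-- in N, and an element c of N above M bounds them all: N ⊨ ∀x∈p ∃y∈c ∃w̄∈c π. By induction on k,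
-- M satisfies Σ_k-collection, so in M the Π_k formulas are closed under bounded quantifiers and
-- B(x, q) := ∃y∈q ∃w̄∈q π is equivalent to a Π_k formula R. The Π_{k+1} statement ∀q ∀x (B → R)
-- holds in M, hence in N, so N ⊨ ∃q ∀x∈p R. Being Σ_{k+1}, this reflects to M, and the q found
-- there collects the witnesses. For k = 0 no collection is needed, which starts the induction.

open import Defs
open import Data.Nat using (ℕ; zero; suc)
open import Data.Product using (Σ; _×_; _,_; proj₁; proj₂)
open import Data.Sum using (_⊎_; inj₁; inj₂; [_,_]′; swap)
open import Data.Empty using (⊥-elim)
open import Function using (_∘_; id)
open import Level using (Level; 0ℓ)
open import Relation.Nullary using (¬_)
open import Relation.Binary.PropositionalEquality using (_≡_; _≗_; refl; sym; cong; cong₂; subst)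
open import Relation.Binary.Bundles using (Setoid)
import Relation.Binary.Reasoning.Setoid as SetoidReasoning

variable
  A B C D : Set
  k j m : ℕ
  φ ψ χ π : Formula
  S : Structure

⇔-refl : A ⇔ A
⇔-refl = id , id

⇔-sym : A ⇔ B → B ⇔ A
⇔-sym (f , g) = g , f

⇔-trans : A ⇔ B → B ⇔ C → A ⇔ C
⇔-trans (f , g) (h , k) = h ∘ f , g ∘ k

≡⇒⇔ : A ≡ B → A ⇔ B
≡⇒⇔ refl = ⇔-refl

¬-cong : A ⇔ B → (¬ A) ⇔ (¬ B)
¬-cong (f , g) = (λ ¬a → ¬a ∘ g) , (λ ¬b → ¬b ∘ f)

×-cong : A ⇔ B → C ⇔ D → (A × C) ⇔ (B × D)
×-cong (f , g) (h , k) = (λ (a , c) → f a , h c) , (λ (b , d) → g b , k d)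

⊎-cong : A ⇔ B → C ⇔ D → (A ⊎ C) ⇔ (B ⊎ D)
⊎-cong (f , g) (h , k) = [ inj₁ ∘ f , inj₂ ∘ h ]′ , [ inj₁ ∘ g , inj₂ ∘ k ]′

→-cong : A ⇔ B → C ⇔ D → (A → C) ⇔ (B → D)
→-cong (f , g) (h , k) = (λ a→c → h ∘ a→c ∘ g) , (λ b→d → k ∘ b→d ∘ f)

Π-cong : {P Q : A → Set} → (∀ x → P x ⇔ Q x) → ((x : A) → P x) ⇔ ((x : A) → Q x)
Π-cong e = (λ h x → proj₁ (e x) (h x)) , (λ h x → proj₂ (e x) (h x))

Σ-cong : {P Q : A → Set} → (∀ x → P x ⇔ Q x) → Σ A P ⇔ Σ A Q
Σ-cong e = (λ (x , p) → x , proj₁ (e x) p) , (λ (x , q) → x , proj₂ (e x) q)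

lift : (ℕ → ℕ) → ℕ → ℕ
lift r zero    = zero
lift r (suc i) = suc (r i)

rename : (ℕ → ℕ) → Formula → Formula
rename r (i ∈̇ j)   = r i ∈̇ r j
rename r (i ≐ j)   = r i ≐ r j
rename r (¬̇ φ)     = ¬̇ rename r φ
rename r (φ ∧̇ ψ)   = rename r φ ∧̇ rename r ψ
rename r (φ ∨̇ ψ)   = rename r φ ∨̇ rename r ψ
rename r (φ ⇒̇ ψ)   = rename r φ ⇒̇ rename r ψ
rename r (∀̇ φ)     = ∀̇ rename (lift r) φ
rename r (∃̇ φ)     = ∃̇ rename (lift r) φ
rename r (∀∈̇ i φ)  = ∀∈̇ (r i) (rename (lift r) φ)
rename r (∃∈̇ i φ)  = ∃∈̇ (r i) (rename (lift r) φ)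

weaken : Formula → Formula
weaken = rename suc

swap01 : ℕ → ℕ
swap01 zero          = 1
swap01 (suc zero)    = 0
swap01 (suc (suc i)) = suc (suc i)

lift-agree : {X : Set} {σ τ : Env X} {x : X} (r : ℕ → ℕ) →
             σ ∘ r ≗ τ → (x ∷ₑ σ) ∘ lift r ≗ x ∷ₑ τ
lift-agree r e zero    = refl
lift-agree r e (suc i) = e i

Sat-rename : ∀ φ {r σ τ} → σ ∘ r ≗ τ → Sat S (rename r φ) σ ⇔ Sat S φ τ
Sat-rename {S} (i ∈̇ j) e = ≡⇒⇔ (cong₂ (Structure._∈_ S) (e i) (e j))
Sat-rename (i ≐ j) e = ≡⇒⇔ (cong₂ _≡_ (e i) (e j))
Sat-rename (¬̇ φ) e = ¬-cong (Sat-rename φ e)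
Sat-rename (φ ∧̇ ψ) e = ×-cong (Sat-rename φ e) (Sat-rename ψ e)
Sat-rename (φ ∨̇ ψ) e = ⊎-cong (Sat-rename φ e) (Sat-rename ψ e)
Sat-rename (φ ⇒̇ ψ) e = →-cong (Sat-rename φ e) (Sat-rename ψ e)
Sat-rename (∀̇ φ) {r} e = Π-cong λ _ → Sat-rename φ (lift-agree r e)
Sat-rename (∃̇ φ) {r} e = Σ-cong λ _ → Sat-rename φ (lift-agree r e)
Sat-rename {S} (∀∈̇ i φ) {r} e =
  Π-cong λ x → →-cong (≡⇒⇔ (cong (Structure._∈_ S x) (e i))) (Sat-rename φ (lift-agree r e))
Sat-rename {S} (∃∈̇ i φ) {r} e =
  Σ-cong λ x → ×-cong (≡⇒⇔ (cong (Structure._∈_ S x) (e i))) (Sat-rename φ (lift-agree r e))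

Sat-weaken : ∀ φ {ρ x} → Sat S (weaken φ) (x ∷ₑ ρ) ⇔ Sat S φ ρ
Sat-weaken φ = Sat-rename φ λ _ → refl

Sat-swap01 : ∀ φ {ρ x y} → Sat S (rename swap01 φ) (x ∷ₑ (y ∷ₑ ρ)) ⇔ Sat S φ (y ∷ₑ (x ∷ₑ ρ))
Sat-swap01 φ = Sat-rename φ λ { zero → refl ; (suc zero) → refl ; (suc (suc i)) → refl }

Δ₀-rename : ∀ r → Δ₀ φ → Δ₀ (rename r φ)
Δ₀-rename r (mem i j)  = mem (r i) (r j)
Δ₀-rename r (eq i j)   = eq (r i) (r j)
Δ₀-rename r (neg d)    = neg (Δ₀-rename r d)
Δ₀-rename r (and d e)  = and (Δ₀-rename r d) (Δ₀-rename r e)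
Δ₀-rename r (or d e)   = or (Δ₀-rename r d) (Δ₀-rename r e)
Δ₀-rename r (imp d e)  = imp (Δ₀-rename r d) (Δ₀-rename r e)
Δ₀-rename r (ball i d) = ball (r i) (Δ₀-rename (lift r) d)
Δ₀-rename r (bex i d)  = bex (r i) (Δ₀-rename (lift r) d)

mutual
  IsΣ-rename : ∀ r → IsΣ k φ → IsΣ k (rename r φ)
  IsΣ-rename r (Σ-Δ₀ d) = Σ-Δ₀ (Δ₀-rename r d)
  IsΣ-rename r (Σ-∃ s)  = Σ-∃ (IsΣ-rename (lift r) s)
  IsΣ-rename r (Σ-Π p)  = Σ-Π (IsΠ-rename r p)

  IsΠ-rename : ∀ r → IsΠ k φ → IsΠ k (rename r φ)
  IsΠ-rename r (Π-Δ₀ d) = Π-Δ₀ (Δ₀-rename r d)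
  IsΠ-rename r (Π-∀ p)  = Π-∀ (IsΠ-rename (lift r) p)
  IsΠ-rename r (Π-Σ s)  = Π-Σ (IsΣ-rename r s)

mutual
  IsΣ-suc : IsΣ k φ → IsΣ (suc k) φ
  IsΣ-suc (Σ-Δ₀ d) = Σ-Δ₀ d
  IsΣ-suc (Σ-∃ s)  = Σ-∃ (IsΣ-suc s)
  IsΣ-suc (Σ-Π p)  = Σ-Π (IsΠ-suc p)

  IsΠ-suc : IsΠ k φ → IsΠ (suc k) φ
  IsΠ-suc (Π-Δ₀ d) = Π-Δ₀ d
  IsΠ-suc (Π-∀ p)  = Π-∀ (IsΠ-suc p)
  IsΠ-suc (Π-Σ s)  = Π-Σ (IsΣ-suc s)

∃ⁿ : ℕ → Formula → Formula
∃ⁿ zero    φ = φ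
∃ⁿ (suc m) φ = ∃̇ ∃ⁿ m φ

liftⁿ : ℕ → (ℕ → ℕ) → ℕ → ℕ
liftⁿ zero    r = r
liftⁿ (suc m) r = liftⁿ m (lift r)

rename-∃ⁿ : ∀ m r φ → rename r (∃ⁿ m φ) ≡ ∃ⁿ m (rename (liftⁿ m r) φ)
rename-∃ⁿ zero    r φ = refl
rename-∃ⁿ (suc m) r φ = cong ∃̇_ (rename-∃ⁿ m (lift r) φ)

∃ⁿ-Σ : ∀ m → IsΠ k π → IsΣ (suc k) (∃ⁿ m π)
∃ⁿ-Σ zero    p = Σ-Π p
∃ⁿ-Σ (suc m) p = Σ-∃ (∃ⁿ-Σ m p)

data PrenexΣ (k : ℕ) : Formula → Set where
  prenex : ∀ m → IsΠ k π → PrenexΣ k (∃ⁿ m π)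

prenexΣ : IsΣ (suc k) φ → PrenexΣ k φ
prenexΣ (Σ-Δ₀ d) = prenex 0 (Π-Δ₀ d)
prenexΣ (Σ-∃ s) with prenexΣ s
... | prenex m p = prenex (suc m) p
prenexΣ (Σ-Π p)  = prenex 0 p

-- All quantifiers of the block are bounded by the same set: the variable i outside the block.
∃∈ⁿ : ℕ → ℕ → Formula → Formula
∃∈ⁿ zero    i φ = φ
∃∈ⁿ (suc m) i φ = ∃∈̇ i (∃∈ⁿ m (suc i) φ)

∃∈ⁿ⇒∃ⁿ : ∀ m {π r i σ τ} → σ ∘ r ≗ τ → Sat S (∃∈ⁿ m i (rename (liftⁿ m r) π)) σ → Sat S (∃ⁿ m π) τ
∃∈ⁿ⇒∃ⁿ zero    {π}     e h           = proj₁ (Sat-rename π e) h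
∃∈ⁿ⇒∃ⁿ (suc m) {r = r} e (w , _ , h) = w , ∃∈ⁿ⇒∃ⁿ m (lift-agree r e) h

-- With π in the context (w̄, y, x, v⃗), |w̄| = m, this is ∃y∈q ∃w̄∈q π in the context (x, q, p, v⃗).
witnessesIn : ℕ → Formula → Formula
witnessesIn m π = ∃∈ⁿ (suc m) 1 (rename (liftⁿ (suc m) (lift (suc ∘ suc))) π)

infix 4 _≈[_]_ _≋_

record _≈[_]_ (φ : Formula) (S : Structure) (ψ : Formula) : Set where
  constructor mk≈
  field
    at : ∀ ρ → Sat S φ ρ ⇔ Sat S ψ ρ

open _≈[_]_

≈-refl : φ ≈[ S ] φ
≈-refl = mk≈ λ _ → ⇔-refl

≈-sym : φ ≈[ S ] ψ → ψ ≈[ S ] φ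
≈-sym e = mk≈ λ ρ → ⇔-sym (at e ρ)

≈-trans : φ ≈[ S ] ψ → ψ ≈[ S ] χ → φ ≈[ S ] χ
≈-trans e e′ = mk≈ λ ρ → ⇔-trans (at e ρ) (at e′ ρ)

≈-setoid : Structure → Setoid 0ℓ 0ℓ
≈-setoid S = record
  { Carrier       = Formula
  ; _≈_           = _≈[ S ]_
  ; isEquivalence = record { refl = ≈-refl ; sym = ≈-sym ; trans = ≈-trans }
  }

module ≈-Reasoning (S : Structure) = SetoidReasoning (≈-setoid S)

_≋_ : Formula → Formula → Set₁
φ ≋ ψ = ∀ S → φ ≈[ S ] ψ

≋-refl : φ ≋ φ
≋-refl _ = ≈-refl

≋-sym : φ ≋ ψ → ψ ≋ φ
≋-sym e S = ≈-sym (e S)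

¬̇-cong : φ ≈[ S ] ψ → ¬̇ φ ≈[ S ] ¬̇ ψ
¬̇-cong e = mk≈ λ ρ → ¬-cong (at e ρ)

∨̇-cong : φ ≈[ S ] ψ → χ ≈[ S ] π → φ ∨̇ χ ≈[ S ] ψ ∨̇ π
∨̇-cong e e′ = mk≈ λ ρ → ⊎-cong (at e ρ) (at e′ ρ)

∀̇-cong : φ ≈[ S ] ψ → ∀̇ φ ≈[ S ] ∀̇ ψ
∀̇-cong e = mk≈ λ ρ → Π-cong λ x → at e (x ∷ₑ ρ)

∃̇-cong : φ ≈[ S ] ψ → ∃̇ φ ≈[ S ] ∃̇ ψ
∃̇-cong e = mk≈ λ ρ → Σ-cong λ x → at e (x ∷ₑ ρ)

∀∈̇-cong : ∀ i → φ ≈[ S ] ψ → ∀∈̇ i φ ≈[ S ] ∀∈̇ i ψ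
∀∈̇-cong i e = mk≈ λ ρ → Π-cong λ x → →-cong ⇔-refl (at e (x ∷ₑ ρ))

∃∈̇-cong : ∀ i → φ ≈[ S ] ψ → ∃∈̇ i φ ≈[ S ] ∃∈̇ i ψ
∃∈̇-cong i e = mk≈ λ ρ → Σ-cong λ x → ×-cong ⇔-refl (at e (x ∷ₑ ρ))

data UpTo {ℓ : Level} (_≈_ : Formula → Formula → Set ℓ) (Class : Formula → Set) (φ : Formula) : Set ℓ where
  ⟨_,_⟩ : Class ψ → ψ ≈ φ → UpTo _≈_ Class φ

-- One formula for all structures, so that it can be moved between M and N.
IsΣ≋ IsΠ≋ : ℕ → Formula → Set₁
IsΣ≋ k = UpTo _≋_ (IsΣ k)
IsΠ≋ k = UpTo _≋_ (IsΠ k)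

IsΣ[_] IsΠ[_] : Structure → ℕ → Formula → Set
IsΣ[ S ] k = UpTo _≈[ S ]_ (IsΣ k)
IsΠ[ S ] k = UpTo _≈[ S ]_ (IsΠ k)

module _ {ℓ} {_≈_ : Formula → Formula → Set ℓ} {Class Class′ : Formula → Set} where

  mapClass : (∀ {ψ} → Class ψ → Class′ ψ) → UpTo _≈_ Class φ → UpTo _≈_ Class′ φ
  mapClass f ⟨ c , e ⟩ = ⟨ f c , e ⟩

module _ {Class : Formula → Set} where

  ≋-resp : UpTo _≋_ Class φ → φ ≋ ψ → UpTo _≋_ Class ψ
  ≋-resp ⟨ c , e ⟩ e′ = ⟨ c , (λ S → ≈-trans (e S) (e′ S)) ⟩

  ≈-resp : UpTo _≈[ S ]_ Class φ → φ ≈[ S ] ψ → UpTo _≈[ S ]_ Class ψ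
  ≈-resp ⟨ c , e ⟩ e′ = ⟨ c , ≈-trans e e′ ⟩

  in-structure : ∀ S → UpTo _≋_ Class φ → UpTo _≈[ S ]_ Class φ
  in-structure S ⟨ c , e ⟩ = ⟨ c , e S ⟩

∃̇-Σ≋ : IsΣ≋ (suc k) φ → IsΣ≋ (suc k) (∃̇ φ)
∃̇-Σ≋ ⟨ s , e ⟩ = ⟨ Σ-∃ s , (λ S → ∃̇-cong (e S)) ⟩

∀̇-Π≋ : IsΠ≋ (suc k) φ → IsΠ≋ (suc k) (∀̇ φ)
∀̇-Π≋ ⟨ p , e ⟩ = ⟨ Π-∀ p , (λ S → ∀̇-cong (e S)) ⟩

∃̇-Π≋ : IsΠ≋ k φ → IsΣ≋ (suc k) (∃̇ φ)
∃̇-Π≋ ⟨ p , e ⟩ = ⟨ Σ-∃ (Σ-Π p) , (λ S → ∃̇-cong (e S)) ⟩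

¬̇∃̇ : ¬̇ ∃̇ φ ≋ ∀̇ ¬̇ φ
¬̇∃̇ S = mk≈ λ ρ → (λ ¬∃ x φx → ¬∃ (x , φx)) , (λ ∀¬ (x , φx) → ∀¬ x φx)

¬̇∃∈̇ : ∀ i → ¬̇ ∃∈̇ i φ ≋ ∀∈̇ i (¬̇ φ)
¬̇∃∈̇ i S = mk≈ λ ρ → (λ ¬∃ x x∈ φx → ¬∃ (x , x∈ , φx)) , (λ ∀¬ (x , x∈ , φx) → ∀¬ x x∈ φx)

∃∈̇-∃̇ : ∀ i → ∃∈̇ i (∃̇ φ) ≋ ∃̇ ∃∈̇ (suc i) (rename swap01 φ)
∃∈̇-∃̇ {φ} i S = mk≈ λ ρ →
  (λ (x , x∈ , w , h) → w , x , x∈ , proj₂ (Sat-swap01 φ) h) ,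
  (λ (w , x , x∈ , h) → x , x∈ , w , proj₁ (Sat-swap01 φ) h)

∨̇-comm : φ ∨̇ ψ ≋ ψ ∨̇ φ
∨̇-comm S = mk≈ λ ρ → swap , swap

-- Prenex moves need a nonempty domain: ρ 0 is the witness when only ψ holds.
∃̇-∨̇ : (∃̇ φ) ∨̇ ψ ≋ ∃̇ (φ ∨̇ weaken ψ)
∃̇-∨̇ {φ} {ψ} S = mk≈ λ ρ →
  [ (λ (x , φx) → x , inj₁ φx) , (λ ψρ → ρ 0 , inj₂ (proj₂ (Sat-weaken ψ) ψρ)) ]′ ,
  (λ (x , h) → [ (λ φx → inj₁ (x , φx)) , (λ ψρ → inj₂ (proj₁ (Sat-weaken ψ) ψρ)) ]′ h)

∨̇-∃̇ : φ ∨̇ (∃̇ ψ) ≋ ∃̇ (weaken φ ∨̇ ψ)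
∨̇-∃̇ {φ} {ψ} S = begin
  φ ∨̇ (∃̇ ψ)            ≈⟨ ∨̇-comm S ⟩
  (∃̇ ψ) ∨̇ φ            ≈⟨ ∃̇-∨̇ S ⟩
  ∃̇ (ψ ∨̇ weaken φ)     ≈⟨ ∃̇-cong (∨̇-comm S) ⟩
  ∃̇ (weaken φ ∨̇ ψ)     ∎
  where open ≈-Reasoning S

collection-law : Coll S k → IsΣ k ψ → ∀ i →
                 ∀∈̇ i (∃̇ ψ) ≈[ S ] ∃̇ ∀∈̇ (suc i) (∃∈̇ 1 (rename (lift (lift suc)) ψ))
collection-law {S} {ψ = ψ} coll s i = mk≈ λ ρ →
  (λ H → let (q , H′) = coll ψ s ρ (ρ i) H in
         q , λ x x∈ → let (y , y∈q , h) = H′ x x∈ in y , y∈q , proj₂ (Sat-rename ψ skip-q) h) ,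
  (λ (q , H′) x x∈ → let (y , _ , h) = H′ x x∈ in y , proj₁ (Sat-rename ψ skip-q) h)
  where
  skip-q : {ρ : Env (Structure.Carrier S)} {q x y : Structure.Carrier S} →
           (y ∷ₑ (x ∷ₑ (q ∷ₑ ρ))) ∘ lift (lift suc) ≗ y ∷ₑ (x ∷ₑ ρ)
  skip-q = lift-agree (lift suc) (lift-agree suc λ _ → refl)

module _ (M : Structure) where

  record BoundedClosure (j : ℕ) : Set where
    field
      ∀∈̇-Σ : ∀ {φ} → IsΣ j φ → ∀ i → IsΣ[ M ] j (∀∈̇ i φ)
      ∀∈̇-Π : ∀ {φ} → IsΠ j φ → ∀ i → IsΠ[ M ] j (∀∈̇ i φ)

  bounded-closure₀ : BoundedClosure 0
  bounded-closure₀ = record { ∀∈̇-Σ = Σ₀ ; ∀∈̇-Π = Π₀ }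
    where
    Σ₀ : IsΣ 0 φ → ∀ i → IsΣ[ M ] 0 (∀∈̇ i φ)
    Σ₀ (Σ-Δ₀ d) i = ⟨ Σ-Δ₀ (ball i d) , ≈-refl ⟩
    Π₀ : IsΠ 0 φ → ∀ i → IsΠ[ M ] 0 (∀∈̇ i φ)
    Π₀ (Π-Δ₀ d) i = ⟨ Π-Δ₀ (ball i d) , ≈-refl ⟩

module EndExtension (M N : Structure) (f : Structure.Carrier M → Structure.Carrier N) where
  open Structure M using () renaming (_∈_ to _∈ᴹ_)
  open Structure N using () renaming (_∈_ to _∈ᴺ_)

  Σ≋-down : ΣElementary M N k f → IsΣ≋ k φ → ∀ ρ → Sat N φ (f ∘ ρ) → Sat M φ ρ
  Σ≋-down (_ , el) ⟨ s , e ⟩ ρ = proj₁ (at (e M) ρ) ∘ proj₂ (el _ s ρ) ∘ proj₂ (at (e N) (f ∘ ρ))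

  end-extension-preimage : IsEndExtension M N f → ∀ {x p} → x ∈ᴺ f p →
                           Σ (Structure.Carrier M) λ x₀ → x₀ ∈ᴹ p × f x₀ ≡ x
  end-extension-preimage ((_ , ∈-iff) , bounded) {x} {p} x∈fp =
    let (x₀ , fx₀≡x) = bounded x p x∈fp in
    x₀ , proj₂ (∈-iff x₀ p) (subst (_∈ᴺ f p) (sym fx₀≡x) x∈fp) , fx₀≡x

  ∃ⁿ-transfer-bounded : ΣElementary M N (suc k) f → IsΠ k π → ∀ {c} → (∀ a → f a ∈ᴺ c) →
    ∀ m {r i τ σ} → σ i ≡ c → σ ∘ r ≗ f ∘ τ →
    Sat M (∃ⁿ m π) τ → Sat N (∃∈ⁿ m i (rename (liftⁿ m r) π)) σ
  ∃ⁿ-transfer-bounded {π = π} (_ , el) p _ zero {τ = τ} _ e h =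
    proj₂ (Sat-rename π e) (proj₁ (el π (Σ-Π p) τ) h)
  ∃ⁿ-transfer-bounded el p below-c (suc m) {r} {τ = τ} {σ} σi≡c e (w , h) =
    f w , subst (f w ∈ᴺ_) (sym σi≡c) (below-c w) , ∃ⁿ-transfer-bounded el p below-c m σi≡c e′ h
    where
    e′ : (f w ∷ₑ σ) ∘ lift r ≗ f ∘ (w ∷ₑ τ)
    e′ zero    = refl
    e′ (suc t) = e t

ΣElementary-pred : {M N : Structure} {f : Structure.Carrier M → Structure.Carrier N} →
                   ΣElementary M N (suc k) f → ΣElementary M N k f
ΣElementary-pred (sub , el) = sub , λ φ s → el φ (IsΣ-suc s)

module _ (lem : LEM) where

  ¬¬-elim : ¬ ¬ A → A
  ¬¬-elim {A} ¬¬a = [ id , ⊥-elim ∘ ¬¬a ]′ (lem A)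

  ¬∀⇒∃¬ : {P : A → Set} → ¬ (∀ x → P x) → Σ A (λ x → ¬ P x)
  ¬∀⇒∃¬ ¬∀ = ¬¬-elim λ ¬∃¬ → ¬∀ λ x → ¬¬-elim λ ¬Px → ¬∃¬ (x , ¬Px)

  ¬̇¬̇ : ¬̇ ¬̇ φ ≋ φ
  ¬̇¬̇ S = mk≈ λ ρ → ¬¬-elim , λ φρ ¬φρ → ¬φρ φρ

  ¬̇∀̇ : ¬̇ ∀̇ φ ≋ ∃̇ ¬̇ φ
  ¬̇∀̇ S = mk≈ λ ρ → ¬∀⇒∃¬ , λ (x , ¬φx) ∀φ → ¬φx (∀φ x)

  ⇒̇-∨̇ : φ ⇒̇ ψ ≋ (¬̇ φ) ∨̇ ψ
  ⇒̇-∨̇ {φ} S = mk≈ λ ρ →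
    (λ φ→ψ → [ inj₂ ∘ φ→ψ , inj₁ ]′ (lem (Sat S φ ρ))) ,
    [ (λ ¬φρ φρ → ⊥-elim (¬φρ φρ)) , (λ ψρ _ → ψρ) ]′

  ∀̇-∨̇ : (∀̇ φ) ∨̇ ψ ≋ ∀̇ (φ ∨̇ weaken ψ)
  ∀̇-∨̇ {φ} {ψ} S = mk≈ λ ρ →
    [ (λ ∀φ x → inj₁ (∀φ x)) , (λ ψρ x → inj₂ (proj₂ (Sat-weaken ψ) ψρ)) ]′ ,
    (λ h → [ inj₂ , (λ ¬ψρ → inj₁ λ x → [ id , (λ w → ⊥-elim (¬ψρ (proj₁ (Sat-weaken ψ) w))) ]′ (h x)) ]′
             (lem (Sat S ψ ρ)))

  ∨̇-∀̇ : φ ∨̇ (∀̇ ψ) ≋ ∀̇ (weaken φ ∨̇ ψ)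
  ∨̇-∀̇ {φ} {ψ} S = begin
    φ ∨̇ (∀̇ ψ)            ≈⟨ ∨̇-comm S ⟩
    (∀̇ ψ) ∨̇ φ            ≈⟨ ∀̇-∨̇ S ⟩
    ∀̇ (ψ ∨̇ weaken φ)     ≈⟨ ∀̇-cong (∨̇-comm S) ⟩
    ∀̇ (weaken φ ∨̇ ψ)     ∎
    where open ≈-Reasoning S

  ∀∈̇-∀̇ : ∀ i → ∀∈̇ i φ ≋ ∀̇ ((¬̇ (0 ∈̇ suc i)) ∨̇ φ)
  ∀∈̇-∀̇ i S = ≈-trans (mk≈ λ _ → ⇔-refl) (∀̇-cong (⇒̇-∨̇ S))


  mutual
    ¬̇-Σ : IsΣ k φ → IsΠ≋ k (¬̇ φ)
    ¬̇-Σ (Σ-Δ₀ d) = ⟨ Π-Δ₀ (neg d) , ≋-refl ⟩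
    ¬̇-Σ (Σ-∃ s)  = ≋-resp (∀̇-Π≋ (¬̇-Σ s)) (≋-sym ¬̇∃̇)
    ¬̇-Σ (Σ-Π p)  = mapClass Π-Σ (¬̇-Π p)

    ¬̇-Π : IsΠ k φ → IsΣ≋ k (¬̇ φ)
    ¬̇-Π (Π-Δ₀ d) = ⟨ Σ-Δ₀ (neg d) , ≋-refl ⟩
    ¬̇-Π (Π-∀ p)  = ≋-resp (∃̇-Σ≋ (¬̇-Π p)) (≋-sym ¬̇∀̇)
    ¬̇-Π (Π-Σ s)  = mapClass Σ-Π (¬̇-Σ s)

  mutual
    ∨̇-Δ₀-Σ : Δ₀ φ → IsΣ k ψ → IsΣ≋ k (φ ∨̇ ψ)
    ∨̇-Δ₀-Σ d (Σ-Δ₀ d′) = ⟨ Σ-Δ₀ (or d d′) , ≋-refl ⟩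
    ∨̇-Δ₀-Σ d (Σ-∃ s)   = ≋-resp (∃̇-Σ≋ (∨̇-Δ₀-Σ (Δ₀-rename suc d) s)) (≋-sym ∨̇-∃̇)
    ∨̇-Δ₀-Σ d (Σ-Π p)   = mapClass Σ-Π (∨̇-Δ₀-Π d p)

    ∨̇-Δ₀-Π : Δ₀ φ → IsΠ k ψ → IsΠ≋ k (φ ∨̇ ψ)
    ∨̇-Δ₀-Π d (Π-Δ₀ d′) = ⟨ Π-Δ₀ (or d d′) , ≋-refl ⟩
    ∨̇-Δ₀-Π d (Π-∀ p)   = ≋-resp (∀̇-Π≋ (∨̇-Δ₀-Π (Δ₀-rename suc d) p)) (≋-sym ∨̇-∀̇)
    ∨̇-Δ₀-Π d (Π-Σ s)   = mapClass Π-Σ (∨̇-Δ₀-Σ d s)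

  mutual
    ∨̇-Σ : IsΣ k φ → IsΣ k ψ → IsΣ≋ k (φ ∨̇ ψ)
    ∨̇-Σ (Σ-Δ₀ d) s′ = ∨̇-Δ₀-Σ d s′
    ∨̇-Σ (Σ-∃ s)  s′ = ≋-resp (∃̇-Σ≋ (∨̇-Σ s (IsΣ-rename suc s′))) (≋-sym ∃̇-∨̇)
    ∨̇-Σ (Σ-Π p)  s′ = ∨̇-Π-Σ p s′

    ∨̇-Π-Σ : IsΠ k φ → IsΣ (suc k) ψ → IsΣ≋ (suc k) (φ ∨̇ ψ)
    ∨̇-Π-Σ p (Σ-Δ₀ d) = ≋-resp (∨̇-Δ₀-Σ d (Σ-Π p)) ∨̇-comm
    ∨̇-Π-Σ p (Σ-∃ s)  = ≋-resp (∃̇-Σ≋ (∨̇-Π-Σ (IsΠ-rename suc p) s)) (≋-sym ∨̇-∃̇)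
    ∨̇-Π-Σ p (Σ-Π p′) = mapClass Σ-Π (∨̇-Π p p′)

    ∨̇-Π : IsΠ k φ → IsΠ k ψ → IsΠ≋ k (φ ∨̇ ψ)
    ∨̇-Π (Π-Δ₀ d) p′ = ∨̇-Δ₀-Π d p′
    ∨̇-Π (Π-∀ p)  p′ = ≋-resp (∀̇-Π≋ (∨̇-Π p (IsΠ-rename suc p′))) (≋-sym ∀̇-∨̇)
    ∨̇-Π (Π-Σ s)  p′ = ∨̇-Σ-Π s p′

    ∨̇-Σ-Π : IsΣ k φ → IsΠ (suc k) ψ → IsΠ≋ (suc k) (φ ∨̇ ψ)
    ∨̇-Σ-Π s (Π-Δ₀ d) = ≋-resp (∨̇-Δ₀-Π d (Π-Σ s)) ∨̇-comm
    ∨̇-Σ-Π s (Π-∀ p)  = ≋-resp (∀̇-Π≋ (∨̇-Σ-Π (IsΣ-rename suc s) p)) (≋-sym ∨̇-∀̇)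
    ∨̇-Σ-Π s (Π-Σ s′) = mapClass Π-Σ (∨̇-Σ s s′)

  ¬̇∀∈̇¬̇ : ∀ i → ¬̇ ∀∈̇ i (¬̇ φ) ≋ ∃∈̇ i φ
  ¬̇∀∈̇¬̇ i S = ≈-trans (¬̇-cong (≈-sym (¬̇∃∈̇ i S))) (¬̇¬̇ S)

  ¬̇∃∈̇¬̇ : ∀ i → ¬̇ ∃∈̇ i (¬̇ φ) ≋ ∀∈̇ i φ
  ¬̇∃∈̇¬̇ i S = ≈-trans (¬̇∃∈̇ i S) (∀∈̇-cong i (¬̇¬̇ S))

  ¬̇-Σ[_] : ∀ S → IsΣ[ S ] k φ → IsΠ[ S ] k (¬̇ φ)
  ¬̇-Σ[ S ] ⟨ s , e ⟩ = ≈-resp (in-structure S (¬̇-Σ s)) (¬̇-cong e)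

  ¬̇-Π≋ : IsΠ≋ k φ → IsΣ≋ k (¬̇ φ)
  ¬̇-Π≋ ⟨ p , e ⟩ = ≋-resp (¬̇-Π p) (λ S → ¬̇-cong (e S))

  ∨̇-Π≋ : IsΠ≋ k φ → IsΠ≋ k ψ → IsΠ≋ k (φ ∨̇ ψ)
  ∨̇-Π≋ ⟨ p , e ⟩ ⟨ p′ , e′ ⟩ = ≋-resp (∨̇-Π p p′) (λ S → ∨̇-cong (e S) (e′ S))

  ∀∈̇-Π≋ : ∀ i → IsΠ≋ k φ → IsΠ≋ k (∀∈̇ i φ)
  ∀∈̇-Π≋ {zero}  i ⟨ Π-Δ₀ d , e ⟩ = ⟨ Π-Δ₀ (ball i d) , (λ S → ∀∈̇-cong i (e S)) ⟩
  ∀∈̇-Π≋ {suc k} i ⟨ p , e ⟩ =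
    ≋-resp (∀̇-Π≋ (∨̇-Δ₀-Π (neg (mem 0 (suc i))) p)) (λ S → ≈-trans (≈-sym (∀∈̇-∀̇ i S)) (∀∈̇-cong i (e S)))

  ¬̇∃∈ⁿ-Π≋ : IsΠ k φ → ∀ l i → IsΠ≋ (suc k) (¬̇ ∃∈ⁿ l i φ)
  ¬̇∃∈ⁿ-Π≋ p zero    i = mapClass Π-Σ (¬̇-Π p)
  ¬̇∃∈ⁿ-Π≋ p (suc l) i = ≋-resp (∀∈̇-Π≋ i (¬̇∃∈ⁿ-Π≋ p l (suc i))) (≋-sym (¬̇∃∈̇ i))

  module _ (M : Structure) where

    module _ (cl : BoundedClosure M j) where
      open BoundedClosure cl

      ∃∈̇-Π : IsΠ j φ → ∀ i → IsΠ[ M ] j (∃∈̇ i φ)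
      ∃∈̇-Π p i with in-structure M (¬̇-Π p)
      ... | ⟨ s , e ⟩ = ≈-resp (¬̇-Σ[ M ] (≈-resp (∀∈̇-Σ s i) (∀∈̇-cong i e))) (¬̇∀∈̇¬̇ i M)

      ∃∈ⁿ-Π : IsΠ j φ → ∀ l i → IsΠ[ M ] j (∃∈ⁿ l i φ)
      ∃∈ⁿ-Π p zero    i = ⟨ p , ≈-refl ⟩
      ∃∈ⁿ-Π p (suc l) i with ∃∈ⁿ-Π p l (suc i)
      ... | ⟨ p′ , e ⟩ = ≈-resp (∃∈̇-Π p′ i) (∃∈̇-cong i e)

      ∃∈̇-∃ⁿ : ∀ m → IsΠ j π → ∀ i → Σ Formula λ π* → IsΠ j π* × ∃ⁿ m π* ≈[ M ] ∃∈̇ i (∃ⁿ m π)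
      ∃∈̇-∃ⁿ zero p i with ∃∈̇-Π p i
      ... | ⟨ p* , e ⟩ = _ , p* , e
      ∃∈̇-∃ⁿ {π} (suc m) p i with ∃∈̇-∃ⁿ m (IsΠ-rename (liftⁿ m swap01) p) (suc i)
      ... | π* , p* , e = π* , p* , (begin
        ∃̇ ∃ⁿ m π*                                            ≈⟨ ∃̇-cong e ⟩
        ∃̇ ∃∈̇ (suc i) (∃ⁿ m (rename (liftⁿ m swap01) π))
          ≡⟨ cong (λ ψ → ∃̇ ∃∈̇ (suc i) ψ) (rename-∃ⁿ m swap01 π) ⟨
        ∃̇ ∃∈̇ (suc i) (rename swap01 (∃ⁿ m π))               ≈⟨ ∃∈̇-∃̇ i M ⟨
        ∃∈̇ i (∃̇ ∃ⁿ m π)                                      ∎)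
        where open ≈-Reasoning M

      ∃∈̇-Σ : IsΣ (suc j) φ → ∀ i → IsΣ[ M ] (suc j) (∃∈̇ i φ)
      ∃∈̇-Σ s i with prenexΣ s
      ... | prenex m p with ∃∈̇-∃ⁿ m p i
      ...   | _ , p* , e = ⟨ ∃ⁿ-Σ m p* , e ⟩

      ∀∈̇-∃ⁿ : Coll M (suc j) → ∀ m → IsΠ j π → ∀ i → IsΣ[ M ] (suc j) (∀∈̇ i (∃ⁿ m π))
      ∀∈̇-∃ⁿ coll zero p i = mapClass Σ-Π (∀∈̇-Π p i)
      ∀∈̇-∃ⁿ {π} coll (suc m) p i with ∃∈̇-∃ⁿ m (IsΠ-rename (liftⁿ m (lift (lift suc))) p) 1
      ... | π* , p* , e with ∀∈̇-∃ⁿ coll m p* (suc i)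
      ...   | ⟨ s , e′ ⟩ = ⟨ Σ-∃ s , (begin
        _                                                                    ≈⟨ ∃̇-cong e′ ⟩
        ∃̇ ∀∈̇ (suc i) (∃ⁿ m π*)                                             ≈⟨ ∃̇-cong (∀∈̇-cong (suc i) e) ⟩
        ∃̇ ∀∈̇ (suc i) (∃∈̇ 1 (∃ⁿ m (rename (liftⁿ m (lift (lift suc))) π)))
          ≡⟨ cong (λ ψ → ∃̇ ∀∈̇ (suc i) (∃∈̇ 1 ψ)) (rename-∃ⁿ m (lift (lift suc)) π) ⟨
        ∃̇ ∀∈̇ (suc i) (∃∈̇ 1 (rename (lift (lift suc)) (∃ⁿ m π)))           ≈⟨ collection-law coll (∃ⁿ-Σ m p) i ⟨
        ∀∈̇ i (∃̇ ∃ⁿ m π)                                                    ∎) ⟩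
        where open ≈-Reasoning M

      bounded-closure-suc : Coll M (suc j) → BoundedClosure M (suc j)
      bounded-closure-suc coll = record { ∀∈̇-Σ = Σ⁺ ; ∀∈̇-Π = Π⁺ }
        where
        Σ⁺ : IsΣ (suc j) φ → ∀ i → IsΣ[ M ] (suc j) (∀∈̇ i φ)
        Σ⁺ s i with prenexΣ s
        ... | prenex m p = ∀∈̇-∃ⁿ coll m p i
        Π⁺ : IsΠ (suc j) φ → ∀ i → IsΠ[ M ] (suc j) (∀∈̇ i φ)
        Π⁺ p i with in-structure M (¬̇-Π p)
        ... | ⟨ s , e ⟩ = ≈-resp (¬̇-Σ[ M ] (≈-resp (∃∈̇-Σ s i) (∃∈̇-cong i e))) (¬̇∃∈̇¬̇ i M)

    bounded-closure : ∀ j → Coll M j → BoundedClosure M j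
    bounded-closure zero    _    = bounded-closure₀ M
    bounded-closure (suc j) coll = bounded-closure-suc (bounded-closure j (λ φ s → coll φ (IsΣ-suc s))) coll

  module _ {M N : Structure} {f : Structure.Carrier M → Structure.Carrier N} where
    open Structure N using () renaming (_∈_ to _∈ᴺ_)
    open EndExtension M N f

    Π≋-up : ΣElementary M N k f → IsΠ≋ k φ → ∀ ρ → Sat M φ ρ → Sat N φ (f ∘ ρ)
    Π≋-up el p ρ Mφ = ¬¬-elim λ ¬Nφ → Σ≋-down el (¬̇-Π≋ p) ρ ¬Nφ Mφ

    -- R agrees with φ only in M; the Π_{k+1} statement ∀q ∀x (φ → R) carries one direction of that to N.
    ∃∀∈-reflection : ΣElementary M N (suc k) f → IsΠ[ M ] k φ → IsΠ≋ (suc k) (¬̇ φ) →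
      ∀ ρ i d → Sat N (∀∈̇ (suc i) φ) (d ∷ₑ (f ∘ ρ)) → Sat M (∃̇ ∀∈̇ (suc i) φ) ρ
    ∃∀∈-reflection {φ = B} el (⟨_,_⟩ {R} R-Π R≈B) ¬B-Π ρ i d NB =
      let (q , MR) = Σ≋-down el (∃̇-Π≋ (∀∈̇-Π≋ (suc i) ⟨ R-Π , ≋-refl ⟩)) ρ (d , λ x x∈ → NB⇒R d x (NB x x∈))
      in q , λ x x∈ → proj₁ (at R≈B _) (MR x x∈)
      where
      NB⇒R : Sat N (∀̇ ∀̇ (B ⇒̇ R)) (f ∘ ρ)
      NB⇒R = Π≋-up el (∀̇-Π≋ (∀̇-Π≋ (≋-resp (∨̇-Π≋ ¬B-Π ⟨ IsΠ-suc R-Π , ≋-refl ⟩) (≋-sym ⇒̇-∨̇))))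
                   ρ λ _ _ → proj₂ (at R≈B _)

    collection-step : IsEndExtension M N f → IsTaller M N f → BoundedClosure M k → ΣElementary M N (suc k) f →
                      Coll M (suc k)
    collection-step {k} ee (c , below-c) cl el φ s ρ p H with prenexΣ s
    ... | prenex {π} m π-Π =
      let (q , witnesses-q) = ∃∀∈-reflection el (∃∈ⁿ-Π M cl π′-Π (suc m) 1) (¬̇∃∈ⁿ-Π≋ π′-Π (suc m) 1)
                                             (p ∷ₑ ρ) 0 c witnesses-c
      in q , λ x x∈p → let (y , y∈q , h) = witnesses-q x x∈p in y , y∈q , ∃∈ⁿ⇒∃ⁿ m skip-q-p h
      where
      π′-Π : IsΠ k (rename (liftⁿ (suc m) (lift (suc ∘ suc))) π)
      π′-Π = IsΠ-rename _ π-Π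
      witnesses-c : ∀ x → x ∈ᴺ f p → Sat N (witnessesIn m π) (x ∷ₑ (c ∷ₑ (f ∘ (p ∷ₑ ρ))))
      witnesses-c x x∈fp with end-extension-preimage ee x∈fp
      ... | x₀ , x₀∈p , refl =
        ∃ⁿ-transfer-bounded el π-Π below-c (suc m) refl (λ { zero → refl ; (suc t) → refl }) (H x₀ x₀∈p)
      skip-q-p : ∀ {y x q} → (y ∷ₑ (x ∷ₑ (q ∷ₑ (p ∷ₑ ρ)))) ∘ lift (lift (suc ∘ suc)) ≗ y ∷ₑ (x ∷ₑ ρ)
      skip-q-p = lift-agree _ (lift-agree _ λ _ → refl)

  collection-from-elementarity : {M N : Structure} {f : Structure.Carrier M → Structure.Carrier N} →
    IsEndExtension M N f → IsTaller M N f → ∀ k → ΣElementary M N (suc k) f → Coll M (suc k)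
  collection-from-elementarity ee tall zero el = collection-step ee tall (bounded-closure₀ _) el
  collection-from-elementarity {M} ee tall (suc k) el = collection-step ee tall closure el
    where
    closure : BoundedClosure M (suc k)
    closure = bounded-closure M (suc k) (collection-from-elementarity ee tall k (ΣElementary-pred el))

mainTheorem12 : LEM → (n : ℕ) (M N : Structure) →
    DB₀ M → Coll M 1 →
    (f : Structure.Carrier M → Structure.Carrier N) →
    IsEndExtension M N f → IsTaller M N f → ΣElementary M N (suc (suc n)) f →
    Coll M (suc (suc n))
mainTheorem12 lem n M N _ _ f ee tall el = collection-from-elementarity lem ee tall (suc n) el
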